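{- Let $1 \leq a \leq b$ be integers and $r \geq 2$. If $b \geq 2a$ then \[N(a,b;r) \geq 2b^r+5b^{r-1}-(2a-4)b^{r-2}+\sum_{i=0}^{r-3} b^i.\] If $b<2a$ then \[N(a,b;r) \geq 3b^r-(2a-5)b^{r-1}-(2a-4)b^{r-2}+2\sum_{i=0}^{r-3} b^i.\] (An inequality $N(a,b;r) \geq M$ means that there is an $r$-coloring of $[1,M-1]$ with no monochromatic $(a,b)$-triple; it holds trivially if $N(a,b;r)$ does not exist.)
   Context: $\mathbf{N}=\{1,2,3,\dots\}$ and $[1,n]=\{1,2,\dots,n\}$. For integers $1 \leq a \leq b$, an $(a,b)$-triple is a set of the form $\{x,ax+d,bx+2d\}$ with $x,d \in \mathbf{N}$. $N(a,b;r)$ is the least positive integer, if it exists, such that every $r$-coloring of $[1,N(a,b;r)]$ contains a monochromatic $(a,b)$-triple. An empty sum equals $0$. -}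

module Defs where

open import Data.Nat using (ℕ; zero; suc; _≤_; _<_)
open import Data.Nat as ℕ using ()
open import Data.Integer as ℤ using (ℤ; +_)
open import Data.Fin using (Fin)
open import Data.Product using (Σ; _×_)
open import Relation.Binary.PropositionalEquality using (_≡_)
open import Relation.Nullary using (¬_)

-- A colouring χ (with r colours) of [1,m] is monochromatic-(a,b)-triple-free if
-- there are no x ≥ 1, d ≥ 1 with x, a x + d, b x + 2 d all in [1,m] and all the same colour.
-- (Only values of χ on [1,m] matter; colourings are given as total functions ℕ → Fin r.)
MonoTriple : (a b r m : ℕ) → (ℕ → Fin r) → Set
MonoTriple a b r m χ =
  Σ ℕ λ x → Σ ℕ λ d →
    1 ≤ x × 1 ≤ d × (b ℕ.* x ℕ.+ 2 ℕ.* d) ≤ m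
    × χ x ≡ χ (a ℕ.* x ℕ.+ d) × χ x ≡ χ (b ℕ.* x ℕ.+ 2 ℕ.* d)

-- "N(a,b;r) ≥ M" (M an integer): there is an r-colouring of [1, M-1]
-- with no monochromatic (a,b)-triple.  Here m = M - 1 and we require + m ℤ.+ 1 ≡ M,
-- i.e. the witness length is stated over ℕ.
NGeq : (a b r : ℕ) → ℤ → Set
NGeq a b r M =
  Σ ℕ λ m → ((+ m) ℤ.+ ℤ.+ 1 ≡ M) ×
    Σ (ℕ → Fin r) λ χ → ¬ MonoTriple a b r m χ

geomSum : ℕ → ℕ → ℕ
geomSum b zero = 0
geomSum b (suc n) = geomSum b n ℕ.+ b ℕ.^ n

-- Colour [1, m] with colour 1 exactly on (b + 1, (b + 1)²] and colour 0 elsewhere. A monochromatic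
-- (a,b)-triple x, y = a x + d, z = b x + 2 d must then have colour 0 with y > (b + 1)², and z is pushed
-- past m: for b ≥ 2a by z = 2y + (b − 2a) x, for b < 2a by 2y = z + (2a − b) x with x ≤ b + 1 (if
-- x > (b + 1)² then already z ≥ b x + 2 is too large). This gives the case r = 2, except for a = b = 1,
-- where a 2-colouring of [1,7] without 3-term progressions is used. A free r-colouring of [1, n]
-- extends to a free (r + 1)-colouring of [1, b (n + 1) + 1] by giving every point above n a new
-- colour, because a triple starting above n ends beyond b (n + 1) + 1. Both bounds satisfy
-- M(r + 1) = b M(r) + 1, respectively b M(r) + 2, so induction on r finishes the proof.

module Submission where

open import Defs
open import Data.Nat using (ℕ; zero; suc; _+_; _*_; _^_; _≤_; _<_; _∸_; z≤n; s≤s; s≤s⁻¹; z<s; _≤?_; _<?_)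
open import Data.Nat as ℕ using ()
open import Data.Nat.Properties
open import Data.Integer as ℤ using (ℤ; +_)
import Data.Integer.Properties as ℤ
import Data.Integer.Tactic.RingSolver as ℤ-Solver
import Data.Nat.Tactic.RingSolver as ℕ-Solver
open import Data.Fin as Fin using (Fin; inject₁; fromℕ) renaming (zero to fz; suc to fs)
open import Data.Fin.Properties using (fromℕ≢inject₁; inject₁-injective)
open import Data.Product using (Σ; ∃; _×_; _,_; proj₁; proj₂)
open import Data.Sum using (_⊎_; inj₁; inj₂)
open import Data.Empty using (⊥-elim)
open import Relation.Nullary using (¬_; Dec; yes; no)
open import Relation.Nullary.Decidable using (map′; _×-dec_; from-no)
open import Data.Nat.DivMod using (_/_; _mod_)
open import Relation.Binary.PropositionalEquality

TripleFree : (a b r m : ℕ) → Set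
TripleFree a b r m = Σ (ℕ → Fin r) λ χ → ¬ MonoTriple a b r m χ

TripleFree-restrict : ∀ {a b r m n} → m ≤ n → TripleFree a b r n → TripleFree a b r m
TripleFree-restrict m≤n (χ , free) = χ , λ (x , d , 1≤x , 1≤d , z≤m , y-col , z-col) →
  free (x , d , 1≤x , 1≤d , ≤-trans z≤m m≤n , y-col , z-col)

b*x+2≤b*x+2*d : ∀ b x {d} → 1 ≤ d → b * x + 2 ≤ b * x + 2 * d
b*x+2≤b*x+2*d b x 1≤d = +-monoʳ-≤ (b * x) (*-monoʳ-≤ 2 1≤d)

extendColouring : ∀ {r} → ℕ → (ℕ → Fin r) → ℕ → Fin (suc r)
extendColouring {r} n χ x with x ≤? n
... | yes _ = inject₁ (χ x)
... | no _  = fromℕ r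

extendColouring-inject₁ : ∀ {r} n (χ : ℕ → Fin r) w c →
  extendColouring n χ w ≡ inject₁ c → w ≤ n × χ w ≡ c
extendColouring-inject₁ n χ w c eq with w ≤? n
... | yes w≤n = w≤n , inject₁-injective eq
... | no _    = ⊥-elim (fromℕ≢inject₁ eq)

TripleFree-extend : ∀ {a b r n} → TripleFree a b r n → TripleFree a b (suc r) (b * suc n + 1)
TripleFree-extend {a} {b} {r} {n} (χ , free) = extendColouring n χ , noTriple
  where
  noTriple : ¬ MonoTriple a b (suc r) (b * suc n + 1) (extendColouring n χ)
  noTriple (x , d , 1≤x , 1≤d , z≤m , y-col , z-col) with x ≤? n
  ... | no x≰n = <⇒≱ (begin-strict
        b * suc n + 1     <⟨ +-monoʳ-< (b * suc n) (s≤s (s≤s z≤n)) ⟩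
        b * suc n + 2     ≤⟨ +-monoˡ-≤ 2 (*-monoʳ-≤ b (≰⇒> x≰n)) ⟩
        b * x + 2         ≤⟨ b*x+2≤b*x+2*d b x 1≤d ⟩
        b * x + 2 * d     ∎) z≤m
    where open ≤-Reasoning
  ... | yes _ =
    let (_ , y-col′) = extendColouring-inject₁ n χ (a * x + d) (χ x) (sym y-col)
        (z-in , z-col′) = extendColouring-inject₁ n χ (b * x + 2 * d) (χ x) (sym z-col)
    in free (x , d , 1≤x , 1≤d , z-in , sym y-col′ , sym z-col′)

NGeq-extend : ∀ {a b r M} k → k ≤ 1 → NGeq a b r M → NGeq a b (suc r) (+ b ℤ.* M ℤ.+ + suc k)
NGeq-extend {a} {b} k k≤1 (m , refl , free) =
  b * suc m + k , length-eq , TripleFree-restrict {a} {b} (+-monoʳ-≤ (b * suc m) k≤1) (TripleFree-extend {a} {b} free)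
  where
  open ≡-Reasoning
  length-eq : + (b * suc m + k) ℤ.+ + 1 ≡ + b ℤ.* (+ m ℤ.+ + 1) ℤ.+ + suc k
  length-eq = begin
    + (b * suc m + k + 1)       ≡⟨ cong +_ (shift b m k) ⟩
    + (b * (m + 1) + suc k)     ≡⟨ cong (ℤ._+ + suc k) (ℤ.pos-* b (m + 1)) ⟩
    + b ℤ.* + (m + 1) ℤ.+ + suc k ∎
    where
    shift : ∀ b m k → b * suc m + k + 1 ≡ b * (m + 1) + suc k
    shift = ℕ-Solver.solve-∀

NGeq-iterate : ∀ {a b} (B : ℕ → ℤ) k → k ≤ 1 →
  (∀ s → B (3 + s) ≡ + b ℤ.* B (2 + s) ℤ.+ + suc k) →
  NGeq a b 2 (B 2) → ∀ s → NGeq a b (2 + s) (B (2 + s))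
NGeq-iterate B k k≤1 B-suc base zero    = base
NGeq-iterate {a} {b} B k k≤1 B-suc base (suc s) =
  subst (NGeq a b (3 + s)) (sym (B-suc s)) (NGeq-extend {a} {b} k k≤1 (NGeq-iterate {a} {b} B k k≤1 B-suc base s))

geomSum-suc : ∀ b n → geomSum b (suc n) ≡ 1 + b * geomSum b n
geomSum-suc b zero    = cong suc (sym (*-zeroʳ b))
geomSum-suc b (suc n) = begin
  geomSum b n + b ^ n + b ^ suc n      ≡⟨ cong (_+ b ^ suc n) (geomSum-suc b n) ⟩
  1 + b * geomSum b n + b * b ^ n      ≡⟨ +-assoc 1 (b * geomSum b n) (b * b ^ n) ⟩
  1 + (b * geomSum b n + b * b ^ n)    ≡⟨ cong suc (*-distribˡ-+ b (geomSum b n) (b ^ n)) ⟨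
  1 + b * geomSum b (suc n)            ∎
  where open ≡-Reasoning

pos-*-scale : ∀ b k n → + (k * (b * n)) ≡ + b ℤ.* + (k * n)
pos-*-scale b k n = trans (cong +_ (*-comm-left k b n)) (ℤ.pos-* b (k * n))
  where
  *-comm-left : ∀ k b n → k * (b * n) ≡ b * (k * n)
  *-comm-left = ℕ-Solver.solve-∀

lowerBound₁ lowerBound₂ : (a b r : ℕ) → ℤ
lowerBound₁ a b r =
  + (2 * b ^ r + 5 * b ^ (r ∸ 1)) ℤ.- (+ (2 * a) ℤ.- + 4) ℤ.* + (b ^ (r ∸ 2)) ℤ.+ + geomSum b (r ∸ 2)
lowerBound₂ a b r =
  + (3 * b ^ r) ℤ.- (+ (2 * a) ℤ.- + 5) ℤ.* + (b ^ (r ∸ 1))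
    ℤ.- (+ (2 * a) ℤ.- + 4) ℤ.* + (b ^ (r ∸ 2)) ℤ.+ + (2 * geomSum b (r ∸ 2))

lowerBound₁-suc : ∀ a b s → lowerBound₁ a b (3 + s) ≡ + b ℤ.* lowerBound₁ a b (2 + s) ℤ.+ + 1
lowerBound₁-suc a b s = begin
  + (2 * b ^ (3 + s) + 5 * b ^ (2 + s)) ℤ.- A ℤ.* + (b ^ (1 + s)) ℤ.+ + geomSum b (1 + s)
    ≡⟨ cong (λ t → t ℤ.- A ℤ.* + (b ^ (1 + s)) ℤ.+ + geomSum b (1 + s))
            (cong₂ ℤ._+_ (pos-*-scale b 2 (b ^ (2 + s))) (pos-*-scale b 5 (b ^ (1 + s)))) ⟩
  B ℤ.* + (2 * b ^ (2 + s)) ℤ.+ B ℤ.* + (5 * b ^ (1 + s)) ℤ.- A ℤ.* + (b ^ (1 + s)) ℤ.+ + geomSum b (1 + s)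
    ≡⟨ cong₂ (λ t u → B ℤ.* + (2 * b ^ (2 + s)) ℤ.+ B ℤ.* + (5 * b ^ (1 + s)) ℤ.- A ℤ.* t ℤ.+ u)
             (ℤ.pos-* b (b ^ s))
             (trans (cong +_ (geomSum-suc b s)) (cong (ℤ._+_ (+ 1)) (ℤ.pos-* b (geomSum b s)))) ⟩
  B ℤ.* + (2 * b ^ (2 + s)) ℤ.+ B ℤ.* + (5 * b ^ (1 + s)) ℤ.- A ℤ.* (B ℤ.* + (b ^ s)) ℤ.+ (+ 1 ℤ.+ B ℤ.* + geomSum b s)
    ≡⟨ factor B (+ (2 * b ^ (2 + s))) (+ (5 * b ^ (1 + s))) A (+ (b ^ s)) (+ geomSum b s) ⟩
  B ℤ.* lowerBound₁ a b (2 + s) ℤ.+ + 1 ∎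
  where
  open ≡-Reasoning
  A = + (2 * a) ℤ.- + 4
  B = + b
  factor : ∀ B P Q A X G →
    B ℤ.* P ℤ.+ B ℤ.* Q ℤ.- A ℤ.* (B ℤ.* X) ℤ.+ (+ 1 ℤ.+ B ℤ.* G) ≡ B ℤ.* (P ℤ.+ Q ℤ.- A ℤ.* X ℤ.+ G) ℤ.+ + 1
  factor = ℤ-Solver.solve-∀

lowerBound₂-suc : ∀ a b s → lowerBound₂ a b (3 + s) ≡ + b ℤ.* lowerBound₂ a b (2 + s) ℤ.+ + 2
lowerBound₂-suc a b s = begin
  + (3 * b ^ (3 + s)) ℤ.- A₅ ℤ.* + (b ^ (2 + s)) ℤ.- A₄ ℤ.* + (b ^ (1 + s)) ℤ.+ + (2 * geomSum b (1 + s))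
    ≡⟨ cong₂ (λ t u → t ℤ.- A₅ ℤ.* + (b ^ (2 + s)) ℤ.- A₄ ℤ.* + (b ^ (1 + s)) ℤ.+ u)
             (pos-*-scale b 3 (b ^ (2 + s))) twice-geomSum-suc ⟩
  B ℤ.* + (3 * b ^ (2 + s)) ℤ.- A₅ ℤ.* + (b ^ (2 + s)) ℤ.- A₄ ℤ.* + (b ^ (1 + s)) ℤ.+ (+ 2 ℤ.+ B ℤ.* + (2 * geomSum b s))
    ≡⟨ cong₂ (λ t u → B ℤ.* + (3 * b ^ (2 + s)) ℤ.- A₅ ℤ.* t ℤ.- A₄ ℤ.* u ℤ.+ (+ 2 ℤ.+ B ℤ.* + (2 * geomSum b s)))
             (ℤ.pos-* b (b ^ (1 + s))) (ℤ.pos-* b (b ^ s)) ⟩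
  B ℤ.* + (3 * b ^ (2 + s)) ℤ.- A₅ ℤ.* (B ℤ.* + (b ^ (1 + s))) ℤ.- A₄ ℤ.* (B ℤ.* + (b ^ s)) ℤ.+ (+ 2 ℤ.+ B ℤ.* + (2 * geomSum b s))
    ≡⟨ factor B (+ (3 * b ^ (2 + s))) A₅ (+ (b ^ (1 + s))) A₄ (+ (b ^ s)) (+ (2 * geomSum b s)) ⟩
  B ℤ.* lowerBound₂ a b (2 + s) ℤ.+ + 2 ∎
  where
  open ≡-Reasoning
  A₅ = + (2 * a) ℤ.- + 5
  A₄ = + (2 * a) ℤ.- + 4
  B = + b
  twice-geomSum-suc : + (2 * geomSum b (1 + s)) ≡ + 2 ℤ.+ B ℤ.* + (2 * geomSum b s)
  twice-geomSum-suc = begin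
    + (2 * geomSum b (1 + s))      ≡⟨ cong (λ g → + (2 * g)) (geomSum-suc b s) ⟩
    + (2 * (1 + b * geomSum b s))  ≡⟨ cong +_ (double b (geomSum b s)) ⟩
    + (2 + b * (2 * geomSum b s))  ≡⟨ cong (ℤ._+_ (+ 2)) (ℤ.pos-* b (2 * geomSum b s)) ⟩
    + 2 ℤ.+ B ℤ.* + (2 * geomSum b s) ∎
    where
    double : ∀ b g → 2 * (1 + b * g) ≡ 2 + b * (2 * g)
    double = ℕ-Solver.solve-∀
  factor : ∀ B T A₅ Y A₄ X G →
    B ℤ.* T ℤ.- A₅ ℤ.* (B ℤ.* Y) ℤ.- A₄ ℤ.* (B ℤ.* X) ℤ.+ (+ 2 ℤ.+ B ℤ.* G)
      ≡ B ℤ.* (T ℤ.- A₅ ℤ.* Y ℤ.- A₄ ℤ.* X ℤ.+ G) ℤ.+ + 2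
  factor = ℤ-Solver.solve-∀

m+k≡n⇒+m≡+n-+k : ∀ {m k n} → m + k ≡ n → + m ≡ + n ℤ.- + k
m+k≡n⇒+m≡+n-+k {m} {k} refl = cancel (+ m) (+ k)
  where
  cancel : ∀ m k → m ≡ m ℤ.+ k ℤ.- k
  cancel = ℤ-Solver.solve-∀

lowerBound₁-two : ∀ a b → lowerBound₁ a b 2 ≡ + (2 * (b * b) + 5 * b + 4) ℤ.- + (2 * a)
lowerBound₁-two a b = begin
  + (2 * b ^ 2 + 5 * b ^ 1) ℤ.- (+ (2 * a) ℤ.- + 4) ℤ.* + 1 ℤ.+ + 0
    ≡⟨ collect (+ (2 * b ^ 2 + 5 * b ^ 1)) (+ (2 * a)) ⟩
  + (2 * b ^ 2 + 5 * b ^ 1 + 4) ℤ.- + (2 * a)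
    ≡⟨ cong (λ n → + (n + 4) ℤ.- + (2 * a)) (cong₂ (λ u v → 2 * u + 5 * v) (cong (b *_) (*-identityʳ b)) (*-identityʳ b)) ⟩
  + (2 * (b * b) + 5 * b + 4) ℤ.- + (2 * a) ∎
  where
  open ≡-Reasoning
  collect : ∀ P A → P ℤ.- (A ℤ.- + 4) ℤ.* + 1 ℤ.+ + 0 ≡ P ℤ.+ + 4 ℤ.- A
  collect = ℤ-Solver.solve-∀

lowerBound₂-two : ∀ a b → lowerBound₂ a b 2 ≡ + (3 * (b * b) + 5 * b + 4) ℤ.- + (2 * a * (b + 1))
lowerBound₂-two a b = begin
  + (3 * b ^ 2) ℤ.- (A ℤ.- + 5) ℤ.* + (b ^ 1) ℤ.- (A ℤ.- + 4) ℤ.* + 1 ℤ.+ + 0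
    ≡⟨ cong₂ (λ u v → + (3 * u) ℤ.- (A ℤ.- + 5) ℤ.* + v ℤ.- (A ℤ.- + 4) ℤ.* + 1 ℤ.+ + 0)
             (cong (b *_) (*-identityʳ b)) (*-identityʳ b) ⟩
  + (3 * (b * b)) ℤ.- (A ℤ.- + 5) ℤ.* + b ℤ.- (A ℤ.- + 4) ℤ.* + 1 ℤ.+ + 0
    ≡⟨ collect (+ (3 * (b * b))) (+ b) A ⟩
  + (3 * (b * b)) ℤ.+ + 5 ℤ.* + b ℤ.+ + 4 ℤ.- A ℤ.* + (b + 1)
    ≡⟨ cong₂ (λ u v → + (3 * (b * b)) ℤ.+ u ℤ.+ + 4 ℤ.- v) (ℤ.pos-* 5 b) (ℤ.pos-* (2 * a) (b + 1)) ⟨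
  + (3 * (b * b) + 5 * b + 4) ℤ.- + (2 * a * (b + 1)) ∎
  where
  open ≡-Reasoning
  A = + (2 * a)
  collect : ∀ T B A → T ℤ.- (A ℤ.- + 5) ℤ.* B ℤ.- (A ℤ.- + 4) ℤ.* + 1 ℤ.+ + 0 ≡ T ℤ.+ + 5 ℤ.* B ℤ.+ + 4 ℤ.- A ℤ.* (B ℤ.+ + 1)
  collect = ℤ-Solver.solve-∀

twoBlock : ℕ → ℕ → Fin 2
twoBlock b x with suc b <? x | x ≤? suc b * suc b
... | yes _ | yes _ = fs fz
... | _     | _     = fz

twoBlock-fs : ∀ b x → twoBlock b x ≡ fs fz → suc b < x × x ≤ suc b * suc b
twoBlock-fs b x eq with suc b <? x | x ≤? suc b * suc b
twoBlock-fs b x eq  | yes b<x | yes x≤H = b<x , x≤H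
twoBlock-fs b x ()  | yes _   | no _
twoBlock-fs b x ()  | no _    | _

twoBlock-fz : ∀ b x → twoBlock b x ≡ fz → x ≤ suc b ⊎ suc b * suc b < x
twoBlock-fz b x eq with suc b <? x | x ≤? suc b * suc b
twoBlock-fz b x ()  | yes _ | yes _
twoBlock-fz b x eq  | yes _ | no x≰H = inj₂ (≰⇒> x≰H)
twoBlock-fz b x eq  | no b≮x | _     = inj₁ (≮⇒≥ b≮x)

suc-b<b*x+2*d : ∀ b {x d} → 1 ≤ x → 1 ≤ d → suc b < b * x + 2 * d
suc-b<b*x+2*d b {x} {d} 1≤x 1≤d = begin-strict
  suc b          <⟨ n<1+n (suc b) ⟩
  2 + b          ≡⟨ +-comm 2 b ⟩
  b + 2          ≡⟨ cong (_+ 2) (*-identityʳ b) ⟨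
  b * 1 + 2      ≤⟨ +-monoˡ-≤ 2 (*-monoʳ-≤ b 1≤x) ⟩
  b * x + 2      ≤⟨ b*x+2≤b*x+2*d b x 1≤d ⟩
  b * x + 2 * d  ∎
  where open ≤-Reasoning

a*x+d≤suc-b⇒b*x+2*d<square : ∀ {a b x d} → 1 ≤ a → 1 ≤ x → 1 ≤ d →
  a * x + d ≤ suc b → b * x + 2 * d < suc b * suc b
a*x+d≤suc-b⇒b*x+2*d<square {a} {b} {x} {d} 1≤a 1≤x 1≤d y≤b+1 = begin-strict
  b * x + 2 * d  ≤⟨ +-mono-≤ (*-monoʳ-≤ b x≤b) (*-monoʳ-≤ 2 d≤b) ⟩
  b * b + 2 * b  <⟨ n<1+n (b * b + 2 * b) ⟩
  suc (b * b + 2 * b) ≡⟨ expand b ⟩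
  suc b * suc b  ∎
  where
  open ≤-Reasoning
  expand : ∀ b → suc (b * b + 2 * b) ≡ suc b * suc b
  expand = ℕ-Solver.solve-∀
  x+d≤b+1 : x + d ≤ suc b
  x+d≤b+1 = ≤-trans (+-monoˡ-≤ d (m≤n*m x a {{ℕ.>-nonZero 1≤a}})) y≤b+1
  x≤b : x ≤ b
  x≤b = s≤s⁻¹ (<-≤-trans (m<m+n x 1≤d) x+d≤b+1)
  d≤b : d ≤ b
  d≤b = s≤s⁻¹ (<-≤-trans (m<n+m d 1≤x) x+d≤b+1)

suc-b<x⇒square<b*x+2*d : ∀ {b x d} → suc b < x → 1 ≤ d → suc b * suc b < b * x + 2 * d
suc-b<x⇒square<b*x+2*d {b} {x} {d} b+1<x 1≤d = begin-strict
  suc b * suc b         <⟨ n<1+n (suc b * suc b) ⟩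
  suc (suc b * suc b)   ≡⟨ expand b ⟩
  b * suc (suc b) + 2   ≤⟨ +-monoˡ-≤ 2 (*-monoʳ-≤ b b+1<x) ⟩
  b * x + 2             ≤⟨ b*x+2≤b*x+2*d b x 1≤d ⟩
  b * x + 2 * d         ∎
  where
  open ≤-Reasoning
  expand : ∀ b → suc (suc b * suc b) ≡ b * suc (suc b) + 2
  expand = ℕ-Solver.solve-∀

twoBlock-triple : ∀ {a b x d} → 1 ≤ a → 1 ≤ x → 1 ≤ d →
  twoBlock b x ≡ twoBlock b (a * x + d) → twoBlock b x ≡ twoBlock b (b * x + 2 * d) →
  (x ≤ suc b ⊎ suc b * suc b < x) × suc b * suc b < a * x + d
twoBlock-triple {a} {b} {x} {d} 1≤a 1≤x 1≤d y-col z-col =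
  sameColour (twoBlock b x) refl (sym y-col) (sym z-col)
  where
  sameColour : ∀ k → twoBlock b x ≡ k → twoBlock b (a * x + d) ≡ k → twoBlock b (b * x + 2 * d) ≡ k →
    (x ≤ suc b ⊎ suc b * suc b < x) × suc b * suc b < a * x + d
  sameColour (fs fz) x-col _ z-col =
    ⊥-elim (<⇒≱ (suc-b<x⇒square<b*x+2*d (proj₁ (twoBlock-fs b x x-col)) 1≤d) (proj₂ (twoBlock-fs b _ z-col)))
  sameColour fz x-col y-col z-col with twoBlock-fz b _ z-col | twoBlock-fz b _ y-col
  ... | inj₁ z≤b+1 | _          = ⊥-elim (<⇒≱ (suc-b<b*x+2*d b 1≤x 1≤d) z≤b+1)
  ... | inj₂ H<z   | inj₁ y≤b+1 = ⊥-elim (<⇒≯ (a*x+d≤suc-b⇒b*x+2*d<square 1≤a 1≤x 1≤d y≤b+1) H<z)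
  ... | inj₂ _     | inj₂ H<y   = twoBlock-fz b x x-col , H<y

twoBlock-tripleFree-2a≤b : ∀ {a b c} → 1 ≤ a → 2 * a + c ≡ b →
  ¬ MonoTriple a b 2 (2 * (b * b) + 4 * b + 3 + c) (twoBlock b)
twoBlock-tripleFree-2a≤b {a} {b} {c} 1≤a 2a+c≡b (x , d , 1≤x , 1≤d , z≤m , y-col , z-col) =
  <⇒≱ m<z z≤m
  where
  open ≤-Reasoning
  H<y = proj₂ (twoBlock-triple 1≤a 1≤x 1≤d y-col z-col)
  m<z : 2 * (b * b) + 4 * b + 3 + c < b * x + 2 * d
  m<z = begin-strict
    2 * (b * b) + 4 * b + 3 + c       <⟨ n<1+n _ ⟩
    suc (2 * (b * b) + 4 * b + 3 + c) ≡⟨ expand b c ⟩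
    2 * suc (suc b * suc b) + c * 1   ≤⟨ +-mono-≤ (*-monoʳ-≤ 2 H<y) (*-monoʳ-≤ c 1≤x) ⟩
    2 * (a * x + d) + c * x           ≡⟨ split a c x d ⟩
    (2 * a + c) * x + 2 * d           ≡⟨ cong (λ b → b * x + 2 * d) 2a+c≡b ⟩
    b * x + 2 * d                     ∎
    where
    expand : ∀ b c → suc (2 * (b * b) + 4 * b + 3 + c) ≡ 2 * suc (suc b * suc b) + c * 1
    expand = ℕ-Solver.solve-∀
    split : ∀ a c x d → 2 * (a * x + d) + c * x ≡ (2 * a + c) * x + 2 * d
    split = ℕ-Solver.solve-∀

twoBlock-tripleFree-b<2a : ∀ {a b f m} → 1 ≤ a → 2 ≤ b → suc b + f ≡ 2 * a →
  m + f * suc b ≡ 2 * (b * b) + 3 * b + 2 → ¬ MonoTriple a b 2 m (twoBlock b)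
twoBlock-tripleFree-b<2a {a} {b} {f} {m} 1≤a 2≤b b+1+f≡2a m+f*[b+1]≡ (x , d , 1≤x , 1≤d , z≤m , y-col , z-col)
  with twoBlock-triple 1≤a 1≤x 1≤d y-col z-col
... | inj₂ H<x , _ = <⇒≱ m<z z≤m
  where
  open ≤-Reasoning
  m<z : m < b * x + 2 * d
  m<z = begin-strict
    m                                   ≤⟨ m≤m+n m (f * suc b) ⟩
    m + f * suc b                       ≡⟨ m+f*[b+1]≡ ⟩
    2 * (b * b) + 3 * b + 2             <⟨ m<m+n _ z<s ⟩
    2 * (b * b) + 3 * b + 2 + suc (b + 3)   ≡⟨ expand b ⟩
    2 * suc (suc b * suc b) + 2         ≤⟨ +-monoˡ-≤ 2 (≤-trans (*-monoʳ-≤ 2 H<x) (*-monoˡ-≤ x 2≤b)) ⟩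
    b * x + 2                           ≤⟨ b*x+2≤b*x+2*d b x 1≤d ⟩
    b * x + 2 * d                       ∎
    where
    expand : ∀ b → 2 * (b * b) + 3 * b + 2 + suc (b + 3) ≡ 2 * suc (suc b * suc b) + 2
    expand = ℕ-Solver.solve-∀
... | inj₁ x≤b+1 , H<y = <⇒≱ (+-cancelʳ-≤ (suc b + f * suc b) (suc m) (b * x + 2 * d) m+K<z+K) z≤m
  where
  open ≤-Reasoning
  m+K<z+K : suc m + (suc b + f * suc b) ≤ b * x + 2 * d + (suc b + f * suc b)
  m+K<z+K = begin
    suc m + (suc b + f * suc b)           ≡⟨ rearrange m b f ⟩
    m + f * suc b + suc (suc b)           ≡⟨ cong (_+ suc (suc b)) m+f*[b+1]≡ ⟩
    2 * (b * b) + 3 * b + 2 + suc (suc b) ≡⟨ expand b ⟩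
    2 * suc (suc b * suc b)               ≤⟨ *-monoʳ-≤ 2 H<y ⟩
    2 * (a * x + d)                       ≡⟨ distrib a x d ⟩
    2 * a * x + 2 * d                     ≡⟨ cong (λ t → t * x + 2 * d) b+1+f≡2a ⟨
    (suc b + f) * x + 2 * d               ≡⟨ split b f x d ⟩
    b * x + 2 * d + (x + f * x)           ≤⟨ +-monoʳ-≤ (b * x + 2 * d) (+-mono-≤ x≤b+1 (*-monoʳ-≤ f x≤b+1)) ⟩
    b * x + 2 * d + (suc b + f * suc b)   ∎
    where
    rearrange : ∀ m b f → suc m + (suc b + f * suc b) ≡ m + f * suc b + suc (suc b)
    rearrange = ℕ-Solver.solve-∀
    expand : ∀ b → 2 * (b * b) + 3 * b + 2 + suc (suc b) ≡ 2 * suc (suc b * suc b)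
    expand = ℕ-Solver.solve-∀
    distrib : ∀ a x d → 2 * (a * x + d) ≡ 2 * a * x + 2 * d
    distrib = ℕ-Solver.solve-∀
    split : ∀ b f x d → (suc b + f) * x + 2 * d ≡ b * x + 2 * d + (x + f * x)
    split = ℕ-Solver.solve-∀

MonoTriple? : ∀ a b r m (χ : ℕ → Fin r) → 1 ≤ b → Dec (MonoTriple a b r m χ)
MonoTriple? a b r m χ 1≤b =
  map′ forgetBounds addBounds (anyUpTo? (λ x → anyUpTo? (λ d → triple? x d) (suc m)) (suc m))
  where
  Triple : ℕ → ℕ → Set
  Triple x d = 1 ≤ x × 1 ≤ d × (b * x + 2 * d) ≤ m × χ x ≡ χ (a * x + d) × χ x ≡ χ (b * x + 2 * d)
  triple? : ∀ x d → Dec (Triple x d)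
  triple? x d = 1 ≤? x ×-dec 1 ≤? d ×-dec b * x + 2 * d ≤? m
                ×-dec χ x Fin.≟ χ (a * x + d) ×-dec χ x Fin.≟ χ (b * x + 2 * d)
  forgetBounds : (∃ λ x → x < suc m × ∃ λ d → d < suc m × Triple x d) → MonoTriple a b r m χ
  forgetBounds (x , _ , d , _ , t) = x , d , t
  addBounds : MonoTriple a b r m χ → ∃ λ x → x < suc m × ∃ λ d → d < suc m × Triple x d
  addBounds (x , d , t@(_ , _ , z≤m , _)) =
    x , s≤s (≤-trans (≤-trans (m≤n*m x b {{ℕ.>-nonZero 1≤b}}) (m≤m+n (b * x) (2 * d))) z≤m) ,
    d , s≤s (≤-trans (≤-trans (m≤m+n d (d + 0)) (m≤n+m (2 * d) (b * x))) z≤m) , t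

pairColouring : ℕ → Fin 2
pairColouring x = ((x ∸ 1) / 2) mod 2

pairColouring-tripleFree : ¬ MonoTriple 1 1 2 7 pairColouring
pairColouring-tripleFree = from-no (MonoTriple? 1 1 2 7 pairColouring ≤-refl)

NGeq-base₁ : ∀ {a b} → 1 ≤ a → 2 * a ≤ b → NGeq a b 2 (lowerBound₁ a b 2)
NGeq-base₁ {a} {b} 1≤a 2a≤b with m≤n⇒∃[o]m+o≡n 2a≤b
... | c , 2a+c≡b = m , length , twoBlock b , twoBlock-tripleFree-2a≤b 1≤a 2a+c≡b
  where
  m = 2 * (b * b) + 4 * b + 3 + c
  m+1+2a : m + 1 + 2 * a ≡ 2 * (b * b) + 5 * b + 4
  m+1+2a = subst (λ b → 2 * (b * b) + 4 * b + 3 + c + 1 + 2 * a ≡ 2 * (b * b) + 5 * b + 4)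
                 2a+c≡b (expand a c)
    where
    expand : ∀ a c → let b = 2 * a + c in 2 * (b * b) + 4 * b + 3 + c + 1 + 2 * a ≡ 2 * (b * b) + 5 * b + 4
    expand = ℕ-Solver.solve-∀
  length : + m ℤ.+ + 1 ≡ lowerBound₁ a b 2
  length = trans (m+k≡n⇒+m≡+n-+k m+1+2a) (sym (lowerBound₁-two a b))

suc-b+f≡2a⇒f*suc-b≤2b²+3b+2 : ∀ {a b f} → a ≤ b → suc b + f ≡ 2 * a → f * suc b ≤ 2 * (b * b) + 3 * b + 2
suc-b+f≡2a⇒f*suc-b≤2b²+3b+2 {a} {b} {f} a≤b b+1+f≡2a = begin
  f * suc b                                   ≤⟨ *-monoˡ-≤ (suc b) (<⇒≤ f<b) ⟩
  b * suc b                                   ≤⟨ m≤m+n (b * suc b) (b * b + 2 * b + 2) ⟩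
  b * suc b + (b * b + 2 * b + 2)             ≡⟨ expand b ⟩
  2 * (b * b) + 3 * b + 2                     ∎
  where
  open ≤-Reasoning
  expand : ∀ b → b * suc b + (b * b + 2 * b + 2) ≡ 2 * (b * b) + 3 * b + 2
  expand = ℕ-Solver.solve-∀
  f<b : f < b
  f<b = +-cancelˡ-< b f b (begin-strict
    b + f       <⟨ n<1+n (b + f) ⟩
    suc b + f   ≡⟨ b+1+f≡2a ⟩
    2 * a       ≤⟨ *-monoʳ-≤ 2 a≤b ⟩
    2 * b       ≡⟨ cong (_+_ b) (+-identityʳ b) ⟩
    b + b       ∎)

NGeq-base₂-≥2 : ∀ {a b} → 1 ≤ a → a ≤ b → b < 2 * a → 2 ≤ b → NGeq a b 2 (lowerBound₂ a b 2)
NGeq-base₂-≥2 {a} {b} 1≤a a≤b b<2a 2≤b with m≤n⇒∃[o]m+o≡n b<2a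
... | f , b+1+f≡2a with m≤n⇒∃[o]m+o≡n (suc-b+f≡2a⇒f*suc-b≤2b²+3b+2 a≤b b+1+f≡2a)
... | m , f*[b+1]+m≡top = m , length , twoBlock b , twoBlock-tripleFree-b<2a 1≤a 2≤b b+1+f≡2a m+f*[b+1]≡top
  where
  open ≡-Reasoning
  m+f*[b+1]≡top : m + f * suc b ≡ 2 * (b * b) + 3 * b + 2
  m+f*[b+1]≡top = trans (+-comm m (f * suc b)) f*[b+1]+m≡top
  m+1+2a[b+1] : m + 1 + 2 * a * (b + 1) ≡ 3 * (b * b) + 5 * b + 4
  m+1+2a[b+1] = begin
    m + 1 + 2 * a * (b + 1)               ≡⟨ cong (λ t → m + 1 + t * (b + 1)) b+1+f≡2a ⟨
    m + 1 + (suc b + f) * (b + 1)         ≡⟨ rearrange m b f ⟩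
    m + f * suc b + (b * b + 2 * b + 2)   ≡⟨ cong (_+ (b * b + 2 * b + 2)) m+f*[b+1]≡top ⟩
    2 * (b * b) + 3 * b + 2 + (b * b + 2 * b + 2) ≡⟨ expand b ⟩
    3 * (b * b) + 5 * b + 4               ∎
    where
    rearrange : ∀ m b f → m + 1 + (suc b + f) * (b + 1) ≡ m + f * suc b + (b * b + 2 * b + 2)
    rearrange = ℕ-Solver.solve-∀
    expand : ∀ b → 2 * (b * b) + 3 * b + 2 + (b * b + 2 * b + 2) ≡ 3 * (b * b) + 5 * b + 4
    expand = ℕ-Solver.solve-∀
  length : + m ℤ.+ + 1 ≡ lowerBound₂ a b 2
  length = trans (m+k≡n⇒+m≡+n-+k m+1+2a[b+1]) (sym (lowerBound₂-two a b))

NGeq-base₂ : ∀ {a b} → 1 ≤ a → a ≤ b → b < 2 * a → NGeq a b 2 (lowerBound₂ a b 2)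
NGeq-base₂ {suc zero}    {suc zero}    _ _ _ = 7 , refl , pairColouring , pairColouring-tripleFree
NGeq-base₂ {suc (suc _)} {suc zero}    _ (s≤s ()) _
NGeq-base₂ {a}           {suc (suc b)} 1≤a a≤b b<2a = NGeq-base₂-≥2 1≤a a≤b b<2a (s≤s (s≤s z≤n))

proposition3p1 : (a b r : ℕ) → 1 ≤ a → a ≤ b → 2 ≤ r →
    (2 ℕ.* a ≤ b →
      NGeq a b r (+ (2 ℕ.* b ℕ.^ r ℕ.+ 5 ℕ.* b ℕ.^ (r ∸ 1)) ℤ.- (+ (2 ℕ.* a) ℤ.- + 4) ℤ.* + (b ℕ.^ (r ∸ 2)) ℤ.+ + geomSum b (r ∸ 2)))
    ×
    (b < 2 ℕ.* a →
      NGeq a b r (+ (3 ℕ.* b ℕ.^ r) ℤ.- (+ (2 ℕ.* a) ℤ.- + 5) ℤ.* + (b ℕ.^ (r ∸ 1)) ℤ.- (+ (2 ℕ.* a) ℤ.- + 4) ℤ.* + (b ℕ.^ (r ∸ 2)) ℤ.+ + (2 ℕ.* geomSum b (r ∸ 2))))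
proposition3p1 a b 1 _ _ (s≤s ())
proposition3p1 a b (suc (suc s)) 1≤a a≤b _ =
  (λ 2a≤b → NGeq-iterate {a} {b} (lowerBound₁ a b) 0 z≤n (lowerBound₁-suc a b) (NGeq-base₁ 1≤a 2a≤b) s) ,
  (λ b<2a → NGeq-iterate {a} {b} (lowerBound₂ a b) 1 ≤-refl (lowerBound₂-suc a b) (NGeq-base₂ 1≤a a≤b b<2a) s)
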